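{- For $1\leq b\leq 4$ and $r\geq 0$ let $S_{N,r}^{(4,b)}=\sum_{k=0}^{r}N_{4k+b}$. Then for every $r\geq 3$, $$S_{N,r}^{(4,b)}=5S_{N,r-1}^{(4,b)}-2S_{N,r-2}^{(4,b)}+S_{N,r-3}^{(4,b)}+c_b,$$ where $c_1=-1$, $c_2=c_4=1$ and $c_3=2$.
   Context: The Narayana numbers $(N_r)_{r\in\mathbb{Z}}$ are defined by $N_0=0$, $N_1=N_2=1$ and $N_r=N_{r-1}+N_{r-3}$ for all integers $r$. -}

module Defs where

open import Data.Nat using (ℕ; zero; suc)
import Data.Nat as ℕ
open import Data.Integer using (ℤ; +_; -[1+_]; _+_)

-- Values taken in ℤ so that the recurrence with constant c_1 = -1 is stated in ℤ.
narayana : ℕ → ℤ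
narayana zero = + 0
narayana (suc zero) = + 1
narayana (suc (suc zero)) = + 1
narayana (suc (suc (suc n))) = narayana (suc (suc n)) + narayana n

S : ℕ → ℕ → ℤ
S b zero = narayana b
S b (suc r) = S b r + narayana (4 ℕ.* suc r ℕ.+ b)

-- the constants c_b for 1 ≤ b ≤ 4 (value at other b irrelevant)
c : ℕ → ℤ
c 1 = -[1+ 0 ]
c 2 = + 1
c 3 = + 2
c 4 = + 1
c _ = + 0

module Submission where

-- The Narayana numbers satisfy N(m+3) = N(m+2) + N(m),
-- a recurrence with characteristic polynomial p(t) = t³ − t² − 1.  The
-- polynomial t¹² − 5t⁸ + 2t⁴ − 1, whose roots are the fourth powers of the
-- roots of p, is divisible by p; the explicit quotient Q certifies that every
-- Narayana-type sequence u obeys u(m+12) = 5u(m+8) − 2u(m+4) + u(m).  Hence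
-- every subsequence a(k) = u(4k+b) obeys the "quadrupled" recurrence
-- a(k+3) = 5a(k+2) − 2a(k+1) + a(k).
--   For any sequence s whose increments obey the quadrupled recurrence, the
-- defect s(n+3) − 5s(n+2) + 2s(n+1) − s(n) is independent of n, since its
-- first difference is the recurrence applied to the increments.  The partial
-- sums S_b are such a sequence, so S_b(r) − 5S_b(r−1) + 2S_b(r−2) − S_b(r−3)
-- equals its value at r = 3, which is computed to be c_b for b = 1,…,4.

open import Defs
open import Data.Nat using (ℕ; _≤_; _∸_; zero; suc; s≤s)
import Data.Nat as ℕ
import Data.Nat.Tactic.RingSolver as ℕSolver
open import Data.Integer using (ℤ; +_; _+_; _-_; _*_; 0ℤ)
open import Data.Integer.Properties using (i≡j⇒i-j≡0; i-j≡0⇒i≡j; +-identityʳ)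
open import Data.Integer.Tactic.RingSolver using (solve-∀)
open import Relation.Binary.PropositionalEquality
  using (_≡_; refl; sym; trans; cong; module ≡-Reasoning)

NarayanaRecurrent : (ℕ → ℤ) → Set
NarayanaRecurrent u = ∀ m → u (3 ℕ.+ m) ≡ u (2 ℕ.+ m) + u m

narayana-recurrent : NarayanaRecurrent narayana
narayana-recurrent m = refl

QuadrupledRecurrent : (ℕ → ℤ) → Set
QuadrupledRecurrent a = ∀ k → a (3 ℕ.+ k) ≡ (+ 5) * a (2 ℕ.+ k) - (+ 2) * a (1 ℕ.+ k) + a k

residual : (ℕ → ℤ) → ℕ → ℤ
residual u m = u (3 ℕ.+ m) - (u (2 ℕ.+ m) + u m)

residual-vanishes : ∀ u → NarayanaRecurrent u → ∀ m → residual u m ≡ 0ℤ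
residual-vanishes u rec m = i≡j⇒i-j≡0 (rec m)

-- Q(E) applied to a sequence ρ, where
-- Q(t) = 1 − t² + t³ − t⁴ − 2t⁵ + 2t⁶ + t⁷ + t⁸ + t⁹ = (t¹² − 5t⁸ + 2t⁴ − 1) / (t³ − t² − 1).
quotientAt : (ℕ → ℤ) → ℤ
quotientAt ρ =
  ρ 0 - ρ 2 + ρ 3 - ρ 4 - (+ 2) * ρ 5 + (+ 2) * ρ 6 + ρ 7 + ρ 8 + ρ 9

quotientAt-zero : ∀ ρ → (∀ i → ρ i ≡ 0ℤ) → quotientAt ρ ≡ 0ℤ
quotientAt-zero ρ vanish
  rewrite vanish 0 | vanish 2 | vanish 3 | vanish 4 | vanish 5
        | vanish 6 | vanish 7 | vanish 8 | vanish 9 = refl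

-- The division t¹² − 5t⁸ + 2t⁴ − 1 = Q(t)·(t³ − t² − 1), written out on the
-- thirteen consecutive values of an arbitrary sequence.
division-certificate : ∀ x0 x1 x2 x3 x4 x5 x6 x7 x8 x9 x10 x11 x12 →
  x12 - ((+ 5) * x8 - (+ 2) * x4 + x0) ≡
    (x3 - (x2 + x0)) - (x5 - (x4 + x2)) + (x6 - (x5 + x3))
    - (x7 - (x6 + x4)) - (+ 2) * (x8 - (x7 + x5))
    + (+ 2) * (x9 - (x8 + x6)) + (x10 - (x9 + x7))
    + (x11 - (x10 + x8)) + (x12 - (x11 + x9))
division-certificate = solve-∀

step-four : ∀ u → NarayanaRecurrent u → ∀ m →
  u (12 ℕ.+ m) ≡ (+ 5) * u (8 ℕ.+ m) - (+ 2) * u (4 ℕ.+ m) + u m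
step-four u rec m = i-j≡0⇒i≡j _ _ (begin
  u (12 ℕ.+ m) - ((+ 5) * u (8 ℕ.+ m) - (+ 2) * u (4 ℕ.+ m) + u m)
    ≡⟨ division-certificate (x 0) (x 1) (x 2) (x 3) (x 4) (x 5) (x 6)
                            (x 7) (x 8) (x 9) (x 10) (x 11) (x 12) ⟩
  quotientAt (λ i → residual u (i ℕ.+ m))
    ≡⟨ quotientAt-zero _ (λ i → residual-vanishes u rec (i ℕ.+ m)) ⟩
  0ℤ ∎)
  where
  open ≡-Reasoning
  x : ℕ → ℤ
  x i = u (i ℕ.+ m)

progression-index : ∀ j k b → 4 ℕ.* (j ℕ.+ k) ℕ.+ b ≡ 4 ℕ.* j ℕ.+ (4 ℕ.* k ℕ.+ b)
progression-index = ℕSolver.solve-∀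

progression-recurrent : ∀ u → NarayanaRecurrent u → ∀ b →
  QuadrupledRecurrent (λ k → u (4 ℕ.* k ℕ.+ b))
progression-recurrent u rec b k = begin
  u (4 ℕ.* (3 ℕ.+ k) ℕ.+ b)
    ≡⟨ cong u (progression-index 3 k b) ⟩
  u (12 ℕ.+ m)
    ≡⟨ step-four u rec m ⟩
  (+ 5) * u (8 ℕ.+ m) - (+ 2) * u (4 ℕ.+ m) + u m
    ≡⟨ sym (cong₃ (λ p q r → (+ 5) * u p - (+ 2) * u q + u r)
                  (progression-index 2 k b) (progression-index 1 k b) (progression-index 0 k b)) ⟩
  (+ 5) * u (4 ℕ.* (2 ℕ.+ k) ℕ.+ b) - (+ 2) * u (4 ℕ.* (1 ℕ.+ k) ℕ.+ b) + u (4 ℕ.* k ℕ.+ b) ∎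
  where
  open ≡-Reasoning
  m : ℕ
  m = 4 ℕ.* k ℕ.+ b
  cong₃ : ∀ (f : ℕ → ℕ → ℕ → ℤ) {p p′ q q′ r r′} →
          p ≡ p′ → q ≡ q′ → r ≡ r′ → f p q r ≡ f p′ q′ r′
  cong₃ f refl refl refl = refl

defect : (ℕ → ℤ) → ℕ → ℤ
defect s n = s (3 ℕ.+ n) - (+ 5) * s (2 ℕ.+ n) + (+ 2) * s (1 ℕ.+ n) - s n

-- Shifting the defect by one adds the quadrupled recurrence applied to the
-- increments d0, …, d3 of a sequence starting at t.
defect-shift : ∀ t d0 d1 d2 d3 →
  let t1 = t + d0 ; t2 = t1 + d1 ; t3 = t2 + d2 ; t4 = t3 + d3 in
  t4 - (+ 5) * t3 + (+ 2) * t2 - t1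
    ≡ t3 - (+ 5) * t2 + (+ 2) * t1 - t + (d3 - ((+ 5) * d2 - (+ 2) * d1 + d0))
defect-shift = solve-∀

defect-invariant : ∀ s d → (∀ m → s (suc m) ≡ s m + d m) → QuadrupledRecurrent d →
  ∀ n → defect s (suc n) ≡ defect s n
defect-invariant s d step rec n
  rewrite step (3 ℕ.+ n) | step (2 ℕ.+ n) | step (1 ℕ.+ n) | step n = begin
    _ ≡⟨ defect-shift (s n) (d n) (d (1 ℕ.+ n)) (d (2 ℕ.+ n)) (d (3 ℕ.+ n)) ⟩
    before + (d (3 ℕ.+ n) - ((+ 5) * d (2 ℕ.+ n) - (+ 2) * d (1 ℕ.+ n) + d n))
      ≡⟨ cong (λ e → before + e) (i≡j⇒i-j≡0 (rec n)) ⟩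
    before + 0ℤ ≡⟨ +-identityʳ before ⟩
    before ∎
  where
  open ≡-Reasoning
  t1 t2 t3 before : ℤ
  t1 = s n + d n
  t2 = t1 + d (1 ℕ.+ n)
  t3 = t2 + d (2 ℕ.+ n)
  before = t3 - (+ 5) * t2 + (+ 2) * t1 - s n

defect-constant : ∀ s d → (∀ m → s (suc m) ≡ s m + d m) → QuadrupledRecurrent d →
  ∀ n → defect s n ≡ defect s 0
defect-constant s d step rec zero = refl
defect-constant s d step rec (suc n) =
  trans (defect-invariant s d step rec n) (defect-constant s d step rec n)

recurrence-with-defect : ∀ s n →
  s (3 ℕ.+ n) ≡ (+ 5) * s (2 ℕ.+ n) - (+ 2) * s (1 ℕ.+ n) + s n + defect s n
recurrence-with-defect s n = solved (s (3 ℕ.+ n)) (s (2 ℕ.+ n)) (s (1 ℕ.+ n)) (s n)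
  where
  solved : ∀ t3 t2 t1 t0 →
    t3 ≡ (+ 5) * t2 - (+ 2) * t1 + t0 + (t3 - (+ 5) * t2 + (+ 2) * t1 - t0)
  solved = solve-∀

initial-defect : ∀ b → 1 ≤ b → b ≤ 4 → defect (S b) 0 ≡ c b
initial-defect 1 _ _ = refl
initial-defect 2 _ _ = refl
initial-defect 3 _ _ = refl
initial-defect 4 _ _ = refl
initial-defect (suc (suc (suc (suc (suc _))))) _ (s≤s (s≤s (s≤s (s≤s ()))))

partial-sums-defect : ∀ b → 1 ≤ b → b ≤ 4 → ∀ n → defect (S b) n ≡ c b
partial-sums-defect b 1≤b b≤4 n =
  trans (defect-constant (S b) increment step increments-recurrent n)
        (initial-defect b 1≤b b≤4)
  where
  increment : ℕ → ℤ
  increment m = narayana (4 ℕ.* suc m ℕ.+ b)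
  step : ∀ m → S b (suc m) ≡ S b m + increment m
  step m = refl
  increments-recurrent : QuadrupledRecurrent increment
  increments-recurrent k = progression-recurrent narayana narayana-recurrent b (suc k)

theorem7 : (b r : ℕ) → 1 ≤ b → b ≤ 4 → 3 ≤ r →
    S b r ≡ (+ 5) * S b (r ∸ 1) - (+ 2) * S b (r ∸ 2) + S b (r ∸ 3) + c b
theorem7 b (suc (suc (suc n))) 1≤b b≤4 _ =
  trans (recurrence-with-defect (S b) n)
        (cong (λ e → (+ 5) * S b (2 ℕ.+ n) - (+ 2) * S b (1 ℕ.+ n) + S b n + e)
              (partial-sums-defect b 1≤b b≤4 n))
theorem7 b 0 _ _ ()
theorem7 b 1 _ _ (s≤s ())
theorem7 b 2 _ _ (s≤s (s≤s ()))
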